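{- Let $M \ge 2$, $N\ge1$ be integers with $\operatorname{rad}(M) \nmid \operatorname{rad}(N)$, let $\xi$ be a primitive $M$-th root of unity, let $r\ge1$, let $p_1, \dots, p_r$ be non-negative integers, let $x_1, \dots, x_r, y_1, \dots, y_r\in\mathbb{C}$, and let $D_r = \sum_{j=1}^r (p_j+1)$. Then $$\sum_{n_1=0}^{M^{p_1+1}-1}\cdots\sum_{n_r=0}^{M^{p_r+1}-1} \xi^{\sum_{j=1}^r \mathcal{B}_{M,N}(n_j)} \Big( \sum_{j=1}^r \big(\mathcal{B}_{M,N}(n_j)x_j + n_j y_j\big) \Big)^{D_r} = (-1)^{D_r} D_r!\, M^{D_r} \frac{\prod_{j=1}^r \prod_{i=0}^{p_j} \big(N^i x_j + M^i y_j \big)}{\prod_{j=1}^r \prod_{i=0}^{p_j} \big(1-\xi^{N^i}\big)}.$$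
   Context: For integers $M\ge 2$, $N \ge 1$ and $n\ge 0$ with base-$M$ expansion $n=\sum_{i\ge 0} d_i(n) M^i$, $d_i(n)\in\{0,\dots,M-1\}$, the base-shifting map is $\mathcal{B}_{M,N}(n) := \sum_{i\ge 0} d_i(n) N^i$. $\operatorname{rad}(k)$ is the product of the distinct prime factors of $k$. -}

module Defs where

open import Level using (Level; _⊔_)
open import Data.Nat using (ℕ; zero; suc; NonZero; _≤_; _<_; _%_; _/_)
import Data.Nat as Nat
open import Data.Nat.Divisibility using (_∣?_)
open import Data.Nat.Primality using (prime?)
open import Data.List using (List; filter; upTo)
open import Data.Nat.ListAction using (product)
open import Data.Vec using (Vec; []; _∷_)
open import Data.Fin using (Fin)
import Data.Fin as Fin
open import Data.Product using (Σ; ∃)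
open import Relation.Nullary using (¬_)
open import Relation.Nullary.Decidable using (_×-dec_)
open import Algebra.Bundles using (CommutativeRing; Semiring)
import Algebra.Definitions.RawSemiring as RawSemiringDefs

-- Base-shifting map B_{M,N}(n) = Σ d_i(n) N^i where n = Σ d_i(n) M^i.
-- Computed digit by digit; the fuel n suffices since n has at most n
-- base-M digits when M ≥ 2 (and the result is 0 once the number is 0).
baseShiftAux : (M N : ℕ) → .{{_ : NonZero M}} → ℕ → ℕ → ℕ
baseShiftAux M N zero    n = 0
baseShiftAux M N (suc f) n = n % M Nat.+ N Nat.* baseShiftAux M N f (n / M)

baseShift : (M N : ℕ) → .{{_ : NonZero M}} → ℕ → ℕ
baseShift M N n = baseShiftAux M N n n

-- rad k : product of the distinct primes dividing k (primes are ≤ k for k ≥ 1).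
rad : ℕ → ℕ
rad k = product (filter (λ q → prime? q ×-dec (q ∣? k)) (upTo (suc k)))

sumFinℕ : (r : ℕ) → (Fin r → ℕ) → ℕ
sumFinℕ zero    f = 0
sumFinℕ (suc r) f = f Fin.zero Nat.+ sumFinℕ r (λ j → f (Fin.suc j))

module RingDefs {c ℓ : Level} (R : CommutativeRing c ℓ) where
  open CommutativeRing R
  open RawSemiringDefs (Semiring.rawSemiring semiring) public using (_×_; _^_)

  sumTo : ℕ → (ℕ → Carrier) → Carrier
  sumTo zero    f = 0#
  sumTo (suc k) f = sumTo k f + f k

  prodTo : ℕ → (ℕ → Carrier) → Carrier
  prodTo zero    f = 1#
  prodTo (suc k) f = prodTo k f * f k

  sumFin : (r : ℕ) → (Fin r → Carrier) → Carrier
  sumFin zero    f = 0#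
  sumFin (suc r) f = f Fin.zero + sumFin r (λ j → f (Fin.suc j))

  prodFin : (r : ℕ) → (Fin r → Carrier) → Carrier
  prodFin zero    f = 1#
  prodFin (suc r) f = f Fin.zero * prodFin r (λ j → f (Fin.suc j))

  multiSum : ∀ {r} → Vec ℕ r → (Vec ℕ r → Carrier) → Carrier
  multiSum []       f = f []
  multiSum (b ∷ bs) f = sumTo b (λ n → multiSum bs (λ ns → f (n ∷ ns)))

  -- R is a field of characteristic zero (the role played by ℂ)
  record IsCharZeroField : Set (c ⊔ ℓ) where
    field
      1≉0     : ¬ (1# ≈ 0#)
      inverse : ∀ a → ¬ (a ≈ 0#) → ∃ λ b → a * b ≈ 1#
      char0   : ∀ n → ¬ (suc n × 1# ≈ 0#)

  IsPrimitiveRoot : ℕ → Carrier → Set ℓ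
  IsPrimitiveRoot M ξ = Σ (ξ ^ M ≈ 1#) λ _ → ((k : ℕ) → 1 ≤ k → k < M → ¬ (ξ ^ k ≈ 1#))

{-# OPTIONS --safe #-}
module Submission where

open import Defs
open import Level using (Level)
open import Data.Nat using (ℕ; suc; NonZero; _≤_; _!)
open import Data.Nat.Divisibility using (_∣_)
open import Data.Fin using (Fin)
open import Data.Vec using (Vec; lookup; tabulate)
open import Relation.Nullary using (¬_)
open import Algebra.Bundles using (CommutativeRing)
import Data.Nat as Nat

open import Data.Nat using (zero; _<_; _∸_; z≤n; s≤s)
import Data.Nat.Properties as ℕₚ
open import Data.Nat.Combinatorics using (_C_; nC1≡n)
import Data.Fin as Fin
open import Data.Vec using ([]; _∷_)
open import Data.List using (List; []; _∷_; _++_; length)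
open import Data.List.Properties using (length-++)
open import Data.List.Relation.Unary.All as All using (All; []; _∷_)
open import Data.List.Relation.Unary.All.Properties using (++⁺)
open import Data.Product using (∃; _,_)
open import Function using (_∘_)
open import Relation.Binary.PropositionalEquality as ≡ using (_≡_)

-- Since B (d + q M) = d + N B q for a digit d < M, splitting each n_j into its
-- base-M digits turns the left-hand side into a sum over all digit vectors of
-- Π_p ω_p^(d_p) · (Σ_p d_p a_p)^D, with one "place" p for each digit position i
-- of each n_j, of coefficient a_p = N^i x_j + M^i y_j and phase ω_p = ξ^(N^i);
-- there are exactly D places.  Expanding binomially in the first digit, the
-- degree-0 term carries Σ_{d<M} ω^d = 0, and each term of degree ≥ 2 leaves a
-- power smaller than the number of remaining places, which vanishes by the same
-- argument.  Only degree-1 terms survive, giving D! Π_p a_p Σ_{d<M} d ω_p^d, and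
-- (1 - ω) Σ_{d<M} d ω^d = -M whenever ω^M = 1 and 1 - ω is a unit.

module _ (M N : ℕ) .{{_ : NonZero M}} where
  open Nat using (_+_; _*_; _%_; _/_)
  open import Data.Nat.DivMod
    using ( m*n%n≡0; 0/n≡0; m/n<m; [m+kn]%n≡m%n; m<n⇒m%n≡m; +-distrib-/-∣ʳ
          ; m<n⇒m/n≡0; m*n/n≡m)
  open import Data.Nat.Divisibility using (divides)

  baseShiftAux-zero : ∀ fuel → baseShiftAux M N fuel 0 ≡ 0
  baseShiftAux-zero zero = ≡.refl
  baseShiftAux-zero (suc fuel) = ≡.trans
    (≡.cong₂ (λ r q → r + N * baseShiftAux M N fuel q) (m*n%n≡0 0 M) (0/n≡0 M))
    (≡.trans (≡.cong (N *_) (baseShiftAux-zero fuel)) (ℕₚ.*-zeroʳ N))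

  n≤1+f⇒n/M≤f : 1 < M → ∀ n f → n ≤ suc f → n / M ≤ f
  n≤1+f⇒n/M≤f _   zero    f _ = ≡.subst (_≤ f) (≡.sym (0/n≡0 M)) z≤n
  n≤1+f⇒n/M≤f 1<M (suc n) f n≤1+f = ℕₚ.≤-pred (ℕₚ.<-≤-trans (m/n<m (suc n) M 1<M) n≤1+f)

  baseShiftAux-fuel : 1 < M → ∀ f g n → n ≤ f → n ≤ g →
                      baseShiftAux M N f n ≡ baseShiftAux M N g n
  baseShiftAux-fuel _   zero    zero    n  _   _   = ≡.refl
  baseShiftAux-fuel _   zero    (suc g) .0 z≤n _   = ≡.sym (baseShiftAux-zero (suc g))
  baseShiftAux-fuel _   (suc f) zero    .0 _   z≤n = baseShiftAux-zero (suc f)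
  baseShiftAux-fuel 1<M (suc f) (suc g) n  n≤f n≤g = ≡.cong (λ t → n % M + N * t)
    (baseShiftAux-fuel 1<M f g (n / M) (n≤1+f⇒n/M≤f 1<M n f n≤f) (n≤1+f⇒n/M≤f 1<M n g n≤g))

  baseShift-step : 1 < M → ∀ n → baseShift M N n ≡ n % M + N * baseShift M N (n / M)
  baseShift-step _ zero = ≡.sym (≡.trans
    (≡.cong₂ (λ r q → r + N * baseShift M N q) (m*n%n≡0 0 M) (0/n≡0 M)) (ℕₚ.*-zeroʳ N))
  baseShift-step 1<M (suc n) = ≡.cong (λ t → suc n % M + N * t)
    (baseShiftAux-fuel 1<M n (suc n / M) (suc n / M)
      (n≤1+f⇒n/M≤f 1<M (suc n) n ℕₚ.≤-refl) ℕₚ.≤-refl)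

  baseShift-digit : 1 < M → ∀ d q → d < M → baseShift M N (d + q * M) ≡ d + N * baseShift M N q
  baseShift-digit 1<M d q d<M = ≡.trans (baseShift-step 1<M (d + q * M))
    (≡.cong₂ (λ s t → s + N * baseShift M N t) digit quotient)
    where
    digit : (d + q * M) % M ≡ d
    digit = ≡.trans ([m+kn]%n≡m%n d q M) (m<n⇒m%n≡m d<M)
    quotient : (d + q * M) / M ≡ q
    quotient = ≡.trans (+-distrib-/-∣ʳ d (divides q ≡.refl))
                       (≡.cong₂ _+_ (m<n⇒m/n≡0 d<M) (m*n/n≡m q M))

module Expansion {c ℓ : Level} (R : CommutativeRing c ℓ) where
  open CommutativeRing R
  open RingDefs R
  open import Algebra.Definitions _≈_ using (Congruent₁)
  open import Relation.Binary.Reasoning.Setoid setoid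
  open import Algebra.Solver.Ring.NaturalCoefficients.Default commutativeSemiring
    using (solve; _:+_; _:*_; _:=_)
  open import Algebra.Properties.Semiring.Exp semiring using (^-congˡ; ^-homo-*; ^-assocʳ)
  open import Algebra.Properties.CommutativeSemiring.Exp commutativeSemiring using (^-distrib-*)
  open import Algebra.Properties.Semiring.Mult semiring
    using (×-congʳ; ×-congˡ; ×-homo-1; ×-homo-+; ×-assocˡ; ×-assoc-*; ×1-homo-*)
  open import Algebra.Properties.CommutativeMonoid.Mult +-commutativeMonoid using (×-distrib-+)
  open import Algebra.Properties.CommutativeSemigroup +-commutativeSemigroup
    using () renaming (interchange to +-interchange; xy∙z≈xz∙y to +-xy∙z≈xz∙y)
  open import Algebra.Properties.CommutativeSemigroup *-commutativeSemigroup
    using () renaming (interchange to *-interchange; x∙yz≈y∙xz to *-x∙yz≈y∙xz)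
  open import Algebra.Properties.Ring ring using (-1*x≈-x; -‿distribʳ-*)
  open import Algebra.Properties.Group +-group using (∙-cancelʳ; inverseˡ-unique)
  open import Algebra.Properties.Semiring.Sum semiring using (sum)
  import Algebra.Properties.CommutativeSemiring.Binomial commutativeSemiring as Binomial

  sumTo-cong-< : ∀ n {f g : ℕ → Carrier} → (∀ i → i < n → f i ≈ g i) → sumTo n f ≈ sumTo n g
  sumTo-cong-< zero    _ = refl
  sumTo-cong-< (suc n) h =
    +-cong (sumTo-cong-< n (λ i i<n → h i (ℕₚ.m<n⇒m<1+n i<n))) (h n (ℕₚ.n<1+n n))

  sumTo-cong : ∀ n {f g : ℕ → Carrier} → (∀ i → f i ≈ g i) → sumTo n f ≈ sumTo n g
  sumTo-cong n h = sumTo-cong-< n (λ i _ → h i)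

  sumTo-zero : ∀ n {f : ℕ → Carrier} → (∀ i → i < n → f i ≈ 0#) → sumTo n f ≈ 0#
  sumTo-zero zero    _ = refl
  sumTo-zero (suc n) h = trans
    (+-cong (sumTo-zero n (λ i i<n → h i (ℕₚ.m<n⇒m<1+n i<n))) (h n (ℕₚ.n<1+n n)))
    (+-identityʳ 0#)

  sumTo-distrib-+ : ∀ n (f g : ℕ → Carrier) →
                    sumTo n (λ i → f i + g i) ≈ sumTo n f + sumTo n g
  sumTo-distrib-+ zero    f g = sym (+-identityʳ 0#)
  sumTo-distrib-+ (suc n) f g = trans (+-congʳ (sumTo-distrib-+ n f g)) (+-interchange _ _ _ _)

  *-distribˡ-sumTo : ∀ n u (f : ℕ → Carrier) → u * sumTo n f ≈ sumTo n (λ i → u * f i)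
  *-distribˡ-sumTo zero    u f = zeroʳ u
  *-distribˡ-sumTo (suc n) u f = trans (distribˡ u _ _) (+-congʳ (*-distribˡ-sumTo n u f))

  *-distribʳ-sumTo : ∀ n u (f : ℕ → Carrier) → sumTo n f * u ≈ sumTo n (λ i → f i * u)
  *-distribʳ-sumTo n u f = trans (*-comm _ u)
    (trans (*-distribˡ-sumTo n u f) (sumTo-cong n (λ i → *-comm u (f i))))

  sumTo-comm : ∀ m n (F : ℕ → ℕ → Carrier) →
               sumTo m (λ i → sumTo n (F i)) ≈ sumTo n (λ j → sumTo m (λ i → F i j))
  sumTo-comm zero    n F = sym (sumTo-zero n (λ _ _ → refl))
  sumTo-comm (suc m) n F = trans (+-congʳ (sumTo-comm m n F)) (sym (sumTo-distrib-+ n _ (F m)))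

  sumTo-suc : ∀ n (f : ℕ → Carrier) → sumTo (suc n) f ≈ f 0 + sumTo n (f ∘ suc)
  sumTo-suc zero    f = +-comm 0# (f 0)
  sumTo-suc (suc n) f = trans (+-congʳ (sumTo-suc n f)) (+-assoc _ _ _)

  sumTo-+ : ∀ m n (f : ℕ → Carrier) →
            sumTo (m Nat.+ n) f ≈ sumTo n f + sumTo m (λ i → f (i Nat.+ n))
  sumTo-+ zero    n f = sym (+-identityʳ _)
  sumTo-+ (suc m) n f = trans (+-congʳ (sumTo-+ m n f)) (+-assoc _ _ _)

  sumTo-* : ∀ m n (f : ℕ → Carrier) →
            sumTo (m Nat.* n) f ≈ sumTo m (λ q → sumTo n (λ d → f (d Nat.+ q Nat.* n)))
  sumTo-* zero    n f = refl
  sumTo-* (suc m) n f = trans (sumTo-+ n (m Nat.* n) f) (+-congʳ (sumTo-* m n f))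

  sum∘toℕ≈sumTo : ∀ n (f : ℕ → Carrier) → sum {n} (f ∘ Fin.toℕ) ≈ sumTo n f
  sum∘toℕ≈sumTo zero    f = refl
  sum∘toℕ≈sumTo (suc n) f = trans (+-congˡ (sum∘toℕ≈sumTo n (f ∘ suc))) (sym (sumTo-suc n f))

  ×≈×1* : ∀ m x → m × x ≈ (m × 1#) * x
  ×≈×1* m x = sym (trans (×-assoc-* m 1# x) (×-congʳ m (*-identityˡ x)))

  binomial-sumTo : ∀ k s e →
    (s + e) ^ k ≈ sumTo (suc k) (λ j → ((k C j) × 1# * e ^ j) * s ^ (k ∸ j))
  binomial-sumTo k s e = begin
    (s + e) ^ k                                             ≈⟨ ^-congˡ k (+-comm s e) ⟩
    (e + s) ^ k                                             ≈⟨ Binomial.theorem k e s ⟩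
    Binomial.binomialExpansion e s k                        ≈⟨ sum∘toℕ≈sumTo (suc k) _ ⟩
    sumTo (suc k) (λ j → (k C j) × (e ^ j * s ^ (k ∸ j)))   ≈⟨ sumTo-cong (suc k) (λ j →
      trans (×≈×1* (k C j) _) (sym (*-assoc _ _ _))) ⟩
    sumTo (suc k) (λ j → ((k C j) × 1# * e ^ j) * s ^ (k ∸ j)) ∎

  multiSum-cong : ∀ {r} (bs : Vec ℕ r) {f g : Vec ℕ r → Carrier} →
                  (∀ ns → f ns ≈ g ns) → multiSum bs f ≈ multiSum bs g
  multiSum-cong []       h = h []
  multiSum-cong (b ∷ bs) h = sumTo-cong b (λ n → multiSum-cong bs (λ ns → h (n ∷ ns)))

  *-distribˡ-multiSum : ∀ {r} (bs : Vec ℕ r) u (f : Vec ℕ r → Carrier) →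
                        u * multiSum bs f ≈ multiSum bs (λ ns → u * f ns)
  *-distribˡ-multiSum []       u f = refl
  *-distribˡ-multiSum (b ∷ bs) u f = trans (*-distribˡ-sumTo b u _)
    (sumTo-cong b (λ n → *-distribˡ-multiSum bs u (λ ns → f (n ∷ ns))))

  prodTo-cong : ∀ n {f g : ℕ → Carrier} → (∀ i → f i ≈ g i) → prodTo n f ≈ prodTo n g
  prodTo-cong zero    h = refl
  prodTo-cong (suc n) h = *-cong (prodTo-cong n h) (h n)

  prodTo-suc : ∀ n (f : ℕ → Carrier) → prodTo (suc n) f ≈ f 0 * prodTo n (f ∘ suc)
  prodTo-suc zero    f = *-comm 1# (f 0)
  prodTo-suc (suc n) f = trans (*-congʳ (prodTo-suc n f)) (*-assoc _ _ _)

  prodFin-cong : ∀ r {f g : Fin r → Carrier} → (∀ j → f j ≈ g j) → prodFin r f ≈ prodFin r g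
  prodFin-cong zero    h = refl
  prodFin-cong (suc r) h = *-cong (h Fin.zero) (prodFin-cong r (h ∘ Fin.suc))

  1#^n≈1# : ∀ n → 1# ^ n ≈ 1#
  1#^n≈1# zero    = refl
  1#^n≈1# (suc n) = trans (*-identityˡ _) (1#^n≈1# n)

  ×1-homo-^ : ∀ m n → (m Nat.^ n) × 1# ≈ (m × 1#) ^ n
  ×1-homo-^ m zero    = +-identityʳ 1#
  ×1-homo-^ m (suc n) = trans (×1-homo-* m (m Nat.^ n)) (*-congˡ (×1-homo-^ m n))

  module _ {a} {A : Set a} where

    prodMap : (A → Carrier) → List A → Carrier
    prodMap f []       = 1#
    prodMap f (x ∷ xs) = f x * prodMap f xs

    prodMap-cong : ∀ {f g : A → Carrier} xs → All (λ x → f x ≈ g x) xs →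
                   prodMap f xs ≈ prodMap g xs
    prodMap-cong []       []       = refl
    prodMap-cong (x ∷ xs) (h ∷ hs) = *-cong h (prodMap-cong xs hs)

    prodMap-++ : ∀ f (xs ys : List A) → prodMap f (xs ++ ys) ≈ prodMap f xs * prodMap f ys
    prodMap-++ f []       ys = sym (*-identityˡ _)
    prodMap-++ f (x ∷ xs) ys = trans (*-congˡ (prodMap-++ f xs ys)) (sym (*-assoc _ _ _))

    prodMap-distrib-* : ∀ f g (xs : List A) →
                        prodMap (λ x → f x * g x) xs ≈ prodMap f xs * prodMap g xs
    prodMap-distrib-* f g []       = sym (*-identityˡ 1#)
    prodMap-distrib-* f g (x ∷ xs) = trans (*-congˡ (prodMap-distrib-* f g xs)) (*-interchange _ _ _ _)

    prodMap-const : ∀ u (xs : List A) → prodMap (λ _ → u) xs ≈ u ^ length xs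
    prodMap-const u []       = refl
    prodMap-const u (x ∷ xs) = *-congˡ (prodMap-const u xs)

    prodMap-unit⇒units : ∀ g (xs : List A) e → prodMap g xs * e ≈ 1# →
                         All (λ x → ∃ λ u → g x * u ≈ 1#) xs
    prodMap-unit⇒units g []       e _  = []
    prodMap-unit⇒units g (x ∷ xs) e ge≈1 = (prodMap g xs * e , trans (sym (*-assoc _ _ _)) ge≈1)
      ∷ prodMap-unit⇒units g xs (g x * e)
          (trans (*-x∙yz≈y∙xz _ _ _) (trans (sym (*-assoc _ _ _)) ge≈1))

    prodMap-inverse : ∀ f g c e (xs : List A) → All (λ x → f x * g x ≈ c) xs →
                      prodMap g xs * e ≈ 1# → prodMap f xs ≈ c ^ length xs * e
    prodMap-inverse f g c e xs fg≈c ge≈1 = begin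
      prodMap f xs                        ≈⟨ sym (*-identityʳ _) ⟩
      prodMap f xs * 1#                   ≈⟨ *-congˡ (sym ge≈1) ⟩
      prodMap f xs * (prodMap g xs * e)   ≈⟨ sym (*-assoc _ _ _) ⟩
      prodMap f xs * prodMap g xs * e     ≈⟨ *-congʳ (sym (prodMap-distrib-* f g xs)) ⟩
      prodMap (λ x → f x * g x) xs * e    ≈⟨ *-congʳ (prodMap-cong xs fg≈c) ⟩
      prodMap (λ _ → c) xs * e            ≈⟨ *-congʳ (prodMap-const c xs) ⟩
      c ^ length xs * e                   ∎

  geometric-sumTo : ∀ ω n → sumTo n (ω ^_) + ω ^ n ≈ 1# + ω * sumTo n (ω ^_)
  geometric-sumTo ω zero    = trans (+-identityˡ 1#) (sym (trans (+-congˡ (zeroʳ ω)) (+-identityʳ 1#)))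
  geometric-sumTo ω (suc n) = trans (+-congʳ (geometric-sumTo ω n))
    (solve 4 (λ S A w o → (o :+ w :* S) :+ w :* A := o :+ w :* (S :+ A)) refl _ _ _ _)

  firstMoment-sumTo : ∀ ω n →
    sumTo n (λ d → ω ^ d * (d × 1#)) + n × ω ^ n ≈
    ω * sumTo n (λ d → ω ^ d * (d × 1#)) + ω * sumTo n (ω ^_)
  firstMoment-sumTo ω zero    =
    trans (+-identityʳ 0#) (sym (trans (+-cong (zeroʳ ω) (zeroʳ ω)) (+-identityʳ 0#)))
  firstMoment-sumTo ω (suc n) = begin
    (T + A * n̂) + (ω * A + n × (ω * A))  ≈⟨ +-congˡ (+-congˡ (×≈×1* n (ω * A))) ⟩
    (T + A * n̂) + (ω * A + n̂ * (ω * A))  ≈⟨ +-congʳ (+-congˡ (*-comm A n̂)) ⟩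
    (T + n̂ * A) + (ω * A + n̂ * (ω * A))
      ≈⟨ +-congʳ (trans (+-congˡ (sym (×≈×1* n A))) (firstMoment-sumTo ω n)) ⟩
    (ω * T + ω * S) + (ω * A + n̂ * (ω * A))
      ≈⟨ solve 5 (λ T A c w S → (w :* T :+ w :* S) :+ (w :* A :+ c :* (w :* A))
                              := w :* (T :+ A :* c) :+ w :* (S :+ A)) refl T A n̂ ω S ⟩
    ω * (T + A * n̂) + ω * (S + A)        ∎
    where
    T S A n̂ : Carrier
    T = sumTo n (λ d → ω ^ d * (d × 1#))
    S = sumTo n (ω ^_)
    A = ω ^ n
    n̂ = n × 1#

  x+a≈b+ωx⇒x[1-ω]+a≈b : ∀ {x a b ω} → x + a ≈ b + ω * x → x * (1# - ω) + a ≈ b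
  x+a≈b+ωx⇒x[1-ω]+a≈b {x} {a} {b} {ω} x+a≈b+ωx = begin
    x * (1# - ω) + a            ≈⟨ +-congʳ (trans (distribˡ x 1# (- ω)) (+-congʳ (*-identityʳ x))) ⟩
    (x + x * - ω) + a           ≈⟨ +-xy∙z≈xz∙y x _ a ⟩
    (x + a) + x * - ω           ≈⟨ +-congʳ x+a≈b+ωx ⟩
    (b + ω * x) + x * - ω       ≈⟨ +-assoc b _ _ ⟩
    b + (ω * x + x * - ω)
      ≈⟨ +-congˡ (+-congˡ (trans (sym (-‿distribʳ-* x ω)) (-‿cong (*-comm x ω)))) ⟩
    b + (ω * x + - (ω * x))     ≈⟨ +-congˡ (-‿inverseʳ _) ⟩
    b + 0#                      ≈⟨ +-identityʳ b ⟩
    b                           ∎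

  record Place : Set c where
    constructor place
    field
      coeff : Carrier
      phase : Carrier
  open Place

  module _ (M : ℕ) where

    phaseSum≈0 : ∀ {ω u} → ω ^ M ≈ 1# → (1# - ω) * u ≈ 1# → sumTo M (ω ^_) ≈ 0#
    phaseSum≈0 {ω} {u} ω^M≈1 [1-ω]u≈1 = begin
      S                    ≈⟨ sym (*-identityʳ S) ⟩
      S * 1#               ≈⟨ *-congˡ (sym [1-ω]u≈1) ⟩
      S * ((1# - ω) * u)   ≈⟨ sym (*-assoc _ _ _) ⟩
      S * (1# - ω) * u     ≈⟨ *-congʳ S[1-ω]≈0 ⟩
      0# * u               ≈⟨ zeroˡ u ⟩
      0#                   ∎
      where
      S : Carrier
      S = sumTo M (ω ^_)
      S[1-ω]≈0 : S * (1# - ω) ≈ 0#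
      S[1-ω]≈0 = ∙-cancelʳ 1# _ _ (trans
        (x+a≈b+ωx⇒x[1-ω]+a≈b (trans (+-congˡ (sym ω^M≈1)) (geometric-sumTo ω M)))
        (sym (+-identityˡ 1#)))

    firstMoment : Carrier → Carrier
    firstMoment ω = sumTo M (λ d → ω ^ d * (d × 1#))

    firstMoment*[1-ω]≈-M : ∀ {ω} → ω ^ M ≈ 1# → sumTo M (ω ^_) ≈ 0# →
                           firstMoment ω * (1# - ω) ≈ - (M × 1#)
    firstMoment*[1-ω]≈-M {ω} ω^M≈1 S≈0 = inverseˡ-unique _ _ (x+a≈b+ωx⇒x[1-ω]+a≈b (begin
      firstMoment ω + M × 1#                        ≈⟨ +-congˡ (×-congʳ M (sym ω^M≈1)) ⟩
      firstMoment ω + M × ω ^ M                     ≈⟨ firstMoment-sumTo ω M ⟩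
      ω * firstMoment ω + ω * sumTo M (ω ^_)        ≈⟨ +-congˡ (trans (*-congˡ S≈0) (zeroʳ ω)) ⟩
      ω * firstMoment ω + 0#                        ≈⟨ +-comm _ 0# ⟩
      0# + ω * firstMoment ω                        ∎))

    placeSum : List Place → (Carrier → Carrier) → Carrier → Carrier
    placeSum []              Φ z = Φ z
    placeSum (place a ω ∷ V) Φ z = sumTo M (λ d → ω ^ d * placeSum V Φ (z + d × a))

    placeSum-cong : ∀ V {Φ Ψ} → (∀ s → Φ s ≈ Ψ s) → ∀ z →
                    placeSum V Φ z ≈ placeSum V Ψ z
    placeSum-cong []              Φ≈Ψ z = Φ≈Ψ z
    placeSum-cong (place a ω ∷ V) Φ≈Ψ z = sumTo-cong M (λ d → *-congˡ (placeSum-cong V Φ≈Ψ _))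

    placeSum-preserves-≈ : ∀ V {Φ} → Congruent₁ Φ → Congruent₁ (placeSum V Φ)
    placeSum-preserves-≈ []              Φ-cong z≈z′ = Φ-cong z≈z′
    placeSum-preserves-≈ (place a ω ∷ V) Φ-cong z≈z′ =
      sumTo-cong M (λ d → *-congˡ (placeSum-preserves-≈ V Φ-cong (+-congʳ z≈z′)))

    placeSum-++ : ∀ V W Φ z → placeSum (V ++ W) Φ z ≈ placeSum V (placeSum W Φ) z
    placeSum-++ []              W Φ z = refl
    placeSum-++ (place a ω ∷ V) W Φ z = sumTo-cong M (λ d → *-congˡ (placeSum-++ V W Φ _))

    placeSum-translate : ∀ V {Φ} → Congruent₁ Φ → ∀ z e →
                         placeSum V Φ (z + e) ≈ placeSum V (λ s → Φ (s + e)) z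
    placeSum-translate []              Φ-cong z e = refl
    placeSum-translate (place a ω ∷ V) Φ-cong z e = sumTo-cong M (λ d → *-congˡ
      (trans (placeSum-preserves-≈ V Φ-cong (+-xy∙z≈xz∙y z e (d × a)))
             (placeSum-translate V Φ-cong (z + d × a) e)))

    placeSum-linear : ∀ V n (c : ℕ → Carrier) (Φ : ℕ → Carrier → Carrier) z →
      placeSum V (λ s → sumTo n (λ j → c j * Φ j s)) z ≈ sumTo n (λ j → c j * placeSum V (Φ j) z)
    placeSum-linear []              n c Φ z = refl
    placeSum-linear (place a ω ∷ V) n c Φ z = begin
      sumTo M (λ d → ω ^ d * placeSum V (λ s → sumTo n (λ j → c j * Φ j s)) (z + d × a))
        ≈⟨ sumTo-cong M (λ d → *-congˡ (placeSum-linear V n c Φ (z + d × a))) ⟩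
      sumTo M (λ d → ω ^ d * sumTo n (λ j → c j * placeSum V (Φ j) (z + d × a)))
        ≈⟨ sumTo-cong M (λ d → trans (*-distribˡ-sumTo n _ _)
                                     (sumTo-cong n (λ j → *-x∙yz≈y∙xz _ _ _))) ⟩
      sumTo M (λ d → sumTo n (λ j → c j * (ω ^ d * placeSum V (Φ j) (z + d × a))))
        ≈⟨ sumTo-comm M n _ ⟩
      sumTo n (λ j → sumTo M (λ d → c j * (ω ^ d * placeSum V (Φ j) (z + d × a))))
        ≈⟨ sumTo-cong n (λ j → sym (*-distribˡ-sumTo M (c j) _)) ⟩
      sumTo n (λ j → c j * placeSum (place a ω ∷ V) (Φ j) z) ∎

    powerSum : List Place → ℕ → Carrier → Carrier
    powerSum V k = placeSum V (_^ k)

    powerSum-translate : ∀ V k z e →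
      powerSum V k (z + e) ≈ sumTo (suc k) (λ j → ((k C j) × 1# * e ^ j) * powerSum V (k ∸ j) z)
    powerSum-translate V k z e = begin
      powerSum V k (z + e)              ≈⟨ placeSum-translate V (^-congˡ k) z e ⟩
      placeSum V (λ s → (s + e) ^ k) z  ≈⟨ placeSum-cong V (λ s → binomial-sumTo k s e) z ⟩
      placeSum V (λ s → sumTo (suc k) (λ j → ((k C j) × 1# * e ^ j) * s ^ (k ∸ j))) z
        ≈⟨ placeSum-linear V (suc k) _ (λ j → _^ (k ∸ j)) z ⟩
      sumTo (suc k) (λ j → ((k C j) × 1# * e ^ j) * powerSum V (k ∸ j) z) ∎

    moment : Place → ℕ → Carrier
    moment (place a ω) j = sumTo M (λ d → ω ^ d * (d × a) ^ j)

    powerSum-∷ : ∀ p V k z →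
      powerSum (p ∷ V) k z ≈ sumTo (suc k) (λ j → ((k C j) × 1# * moment p j) * powerSum V (k ∸ j) z)
    powerSum-∷ (place a ω) V k z = begin
      sumTo M (λ d → ω ^ d * powerSum V k (z + d × a))
        ≈⟨ sumTo-cong M (λ d → trans (*-congˡ (powerSum-translate V k z (d × a)))
                                     (*-distribˡ-sumTo (suc k) _ _)) ⟩
      sumTo M (λ d → sumTo (suc k) (λ j → ω ^ d * ((κ j * (d × a) ^ j) * P j)))
        ≈⟨ sumTo-comm M (suc k) _ ⟩
      sumTo (suc k) (λ j → sumTo M (λ d → ω ^ d * ((κ j * (d × a) ^ j) * P j)))
        ≈⟨ sumTo-cong (suc k) pull-out ⟩
      sumTo (suc k) (λ j → (κ j * moment (place a ω) j) * P j) ∎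
      where
      κ : ℕ → Carrier
      κ j = (k C j) × 1#
      P : ℕ → Carrier
      P j = powerSum V (k ∸ j) z
      pull-out : ∀ j → sumTo M (λ d → ω ^ d * ((κ j * (d × a) ^ j) * P j)) ≈
                       (κ j * moment (place a ω) j) * P j
      pull-out j = begin
        sumTo M (λ d → ω ^ d * ((κ j * (d × a) ^ j) * P j))
          ≈⟨ sumTo-cong M (λ d →
               solve 4 (λ w c x p → w :* ((c :* x) :* p) := (c :* (w :* x)) :* p) refl _ _ _ _) ⟩
        sumTo M (λ d → (κ j * (ω ^ d * (d × a) ^ j)) * P j)
          ≈⟨ sym (*-distribʳ-sumTo M (P j) _) ⟩
        sumTo M (λ d → κ j * (ω ^ d * (d × a) ^ j)) * P j
          ≈⟨ *-congʳ (sym (*-distribˡ-sumTo M (κ j) _)) ⟩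
        (κ j * moment (place a ω) j) * P j ∎

    PhaseSumVanishes : Place → Set ℓ
    PhaseSumVanishes p = sumTo M (phase p ^_) ≈ 0#

    powerSum-∷-vanishing : ∀ p V → PhaseSumVanishes p → ∀ k z →
      powerSum (p ∷ V) k z ≈
      sumTo k (λ j → ((k C suc j) × 1# * moment p (suc j)) * powerSum V (k ∸ suc j) z)
    powerSum-∷-vanishing (place a ω) V Σωᵈ≈0 k z = begin
      powerSum (place a ω ∷ V) k z
        ≈⟨ trans (powerSum-∷ (place a ω) V k z) (sumTo-suc k term) ⟩
      term 0 + sumTo k (term ∘ suc)
        ≈⟨ +-congʳ (trans (*-congʳ (trans (*-congˡ moment₀≈0) (zeroʳ _))) (zeroˡ _)) ⟩
      0# + sumTo k (term ∘ suc)
        ≈⟨ +-identityˡ _ ⟩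
      sumTo k (term ∘ suc) ∎
      where
      term : ℕ → Carrier
      term j = ((k C j) × 1# * moment (place a ω) j) * powerSum V (k ∸ j) z
      moment₀≈0 : moment (place a ω) 0 ≈ 0#
      moment₀≈0 = trans (sumTo-cong M (λ d → *-identityʳ _)) Σωᵈ≈0

    powerSum-vanishes : ∀ V → All PhaseSumVanishes V → ∀ k z → k < length V → powerSum V k z ≈ 0#
    powerSum-vanishes (p ∷ V) (h ∷ hs) k z (s≤s k≤|V|) =
      trans (powerSum-∷-vanishing p V h k z) (sumTo-zero k term≈0)
      where
      term≈0 : ∀ j → j < k → ((k C suc j) × 1# * moment p (suc j)) * powerSum V (k ∸ suc j) z ≈ 0#
      term≈0 j j<k = trans (*-congˡ (powerSum-vanishes V hs (k ∸ suc j) z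
        (ℕₚ.<-≤-trans (ℕₚ.∸-monoʳ-< {o = 0} (s≤s z≤n) j<k) k≤|V|))) (zeroʳ _)

    moment₁ : ∀ p → moment p 1 ≈ coeff p * firstMoment (phase p)
    moment₁ (place a ω) = trans (sumTo-cong M term) (sym (*-distribˡ-sumTo M a _))
      where
      term : ∀ d → ω ^ d * (d × a) ^ 1 ≈ a * (ω ^ d * (d × 1#))
      term d = trans (*-congˡ (trans (*-identityʳ _) (×≈×1* d a)))
        (solve 3 (λ w x a → w :* (x :* a) := a :* (w :* x)) refl _ _ _)

    powerSum-top : ∀ V → All PhaseSumVanishes V → ∀ {k} → length V ≡ k → ∀ z →
      powerSum V k z ≈ ((k !) × 1#) * prodMap (λ p → coeff p * firstMoment (phase p)) V
    powerSum-top []       []       ≡.refl z = sym (trans (*-identityʳ _) (+-identityʳ 1#))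
    powerSum-top (p ∷ V) (h ∷ hs) {suc m} ≡.refl z = begin
      powerSum (p ∷ V) (suc m) z
        ≈⟨ trans (powerSum-∷-vanishing p V h (suc m) z) (sumTo-suc m term) ⟩
      term 0 + sumTo m (term ∘ suc)
        ≈⟨ trans (+-congˡ (sumTo-zero m higher≈0)) (+-identityʳ _) ⟩
      ((suc m C 1) × 1# * moment p 1) * powerSum V m z
        ≈⟨ *-cong (*-cong (×-congˡ (nC1≡n (suc m))) (moment₁ p)) (powerSum-top V hs ≡.refl z) ⟩
      (suc m × 1# * t) * (((m !) × 1#) * Π)
        ≈⟨ *-interchange _ _ _ _ ⟩
      (suc m × 1# * ((m !) × 1#)) * (t * Π)
        ≈⟨ *-congʳ (sym (×1-homo-* (suc m) (m !))) ⟩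
      ((suc m !) × 1#) * (t * Π) ∎
      where
      t Π : Carrier
      t = coeff p * firstMoment (phase p)
      Π = prodMap (λ p → coeff p * firstMoment (phase p)) V
      term : ℕ → Carrier
      term j = ((suc m C suc j) × 1# * moment p (suc j)) * powerSum V (m ∸ j) z
      higher≈0 : ∀ j → j < m → term (suc j) ≈ 0#
      higher≈0 j j<m = trans (*-congˡ (powerSum-vanishes V hs (m ∸ suc j) z
        (ℕₚ.∸-monoʳ-< {o = 0} (s≤s z≤n) j<m))) (zeroʳ _)

    phaseSums-vanish : ∀ V d → All (λ p → phase p ^ M ≈ 1#) V →
                       prodMap (λ p → 1# - phase p) V * d ≈ 1# → All PhaseSumVanishes V
    phaseSums-vanish V d roots [1-phase]*d≈1 = All.zipWith
      (λ (ω^M≈1 , (_ , [1-ω]u≈1)) → phaseSum≈0 ω^M≈1 [1-ω]u≈1)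
      (roots , prodMap-unit⇒units (λ p → 1# - phase p) V d [1-phase]*d≈1)

    powerSum-closedForm : ∀ V d → All (λ p → phase p ^ M ≈ 1#) V →
      prodMap (λ p → 1# - phase p) V * d ≈ 1# → ∀ {k} → length V ≡ k → ∀ z →
      powerSum V k z ≈ ((k !) × 1#) * (prodMap coeff V * ((- (M × 1#)) ^ k * d))
    powerSum-closedForm V d roots [1-phase]*d≈1 {k} ≡.refl z = begin
      powerSum V k z
        ≈⟨ powerSum-top V vanishing ≡.refl z ⟩
      ((k !) × 1#) * prodMap (λ p → coeff p * firstMoment (phase p)) V
        ≈⟨ *-congˡ (prodMap-distrib-* coeff (firstMoment ∘ phase) V) ⟩
      ((k !) × 1#) * (prodMap coeff V * prodMap (firstMoment ∘ phase) V)
        ≈⟨ *-congˡ (*-congˡ (prodMap-inverse (firstMoment ∘ phase) (λ p → 1# - phase p)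
                                             (- (M × 1#)) d V firstMoments [1-phase]*d≈1)) ⟩
      ((k !) × 1#) * (prodMap coeff V * ((- (M × 1#)) ^ k * d)) ∎
      where
      vanishing : All PhaseSumVanishes V
      vanishing = phaseSums-vanish V d roots [1-phase]*d≈1
      firstMoments : All (λ p → firstMoment (phase p) * (1# - phase p) ≈ - (M × 1#)) V
      firstMoments = All.zipWith (λ (ω^M≈1 , S≈0) → firstMoment*[1-ω]≈-M ω^M≈1 S≈0)
                                 (roots , vanishing)

    closedForm-normalise : ∀ D f d →
      ((D !) × 1#) * (f * ((- (M × 1#)) ^ D * d)) ≈ (- 1#) ^ D * ((D ! Nat.* M Nat.^ D) × 1#) * f * d
    closedForm-normalise D f d = begin
      D! * (f * ((- m) ^ D * d))
        ≈⟨ *-congˡ (*-congˡ (*-congʳ (^-congˡ D (sym (-1*x≈-x m))))) ⟩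
      D! * (f * ((- 1# * m) ^ D * d))
        ≈⟨ *-congˡ (*-congˡ (*-congʳ (^-distrib-* (- 1#) m D))) ⟩
      D! * (f * (((- 1#) ^ D * m ^ D) * d))
        ≈⟨ solve 5 (λ D! f s mᴰ d → D! :* (f :* ((s :* mᴰ) :* d)) := s :* (D! :* mᴰ) :* f :* d)
                   refl _ _ _ _ _ ⟩
      (- 1#) ^ D * (D! * m ^ D) * f * d
        ≈⟨ *-congʳ (*-congʳ (*-congˡ D!*mᴰ)) ⟩
      (- 1#) ^ D * ((D ! Nat.* M Nat.^ D) × 1#) * f * d ∎
      where
      D! m : Carrier
      D! = (D !) × 1#
      m = M × 1#
      D!*mᴰ : D! * m ^ D ≈ (D ! Nat.* M Nat.^ D) × 1#
      D!*mᴰ = trans (*-congˡ (sym (×1-homo-^ M D))) (sym (×1-homo-* (D !) (M Nat.^ D)))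

  module _ (M N : ℕ) .{{_ : NonZero M}} where

    private
      B : ℕ → ℕ
      B = baseShift M N

    digitPlaces : ℕ → Carrier → Carrier → Carrier → List Place
    digitPlaces zero    ω X Y = []
    digitPlaces (suc k) ω X Y = place (X + Y) ω ∷ digitPlaces k (ω ^ N) (N × X) (M × Y)

    baseShift-term : 1 < M → ∀ ω X Y {Ψ} → Congruent₁ Ψ → ∀ z d q → d < M →
      ω ^ B (d Nat.+ q Nat.* M) * Ψ (z + (B (d Nat.+ q Nat.* M) × X + (d Nat.+ q Nat.* M) × Y)) ≈
      ω ^ d * ((ω ^ N) ^ B q * Ψ ((z + d × (X + Y)) + (B q × (N × X) + q × (M × Y))))
    baseShift-term 1<M ω X Y {Ψ} Ψ-cong z d q d<M = begin
      ω ^ B n * Ψ (z + (B n × X + n × Y))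
        ≡⟨ ≡.cong (λ t → ω ^ t * Ψ (z + (t × X + n × Y))) (baseShift-digit M N 1<M d q d<M) ⟩
      ω ^ (d Nat.+ N Nat.* B q) * Ψ (z + ((d Nat.+ N Nat.* B q) × X + n × Y))
        ≈⟨ *-cong phase-split (Ψ-cong argument-split) ⟩
      (ω ^ d * (ω ^ N) ^ B q) * Ψ ((z + d × (X + Y)) + (B q × (N × X) + q × (M × Y)))
        ≈⟨ *-assoc _ _ _ ⟩
      ω ^ d * ((ω ^ N) ^ B q * Ψ ((z + d × (X + Y)) + (B q × (N × X) + q × (M × Y)))) ∎
      where
      n : ℕ
      n = d Nat.+ q Nat.* M
      phase-split : ω ^ (d Nat.+ N Nat.* B q) ≈ ω ^ d * (ω ^ N) ^ B q
      phase-split = trans (^-homo-* ω d (N Nat.* B q)) (*-congˡ (sym (^-assocʳ ω N (B q))))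
      argument-split : z + ((d Nat.+ N Nat.* B q) × X + n × Y) ≈
                       (z + d × (X + Y)) + (B q × (N × X) + q × (M × Y))
      argument-split = begin
        z + ((d Nat.+ N Nat.* B q) × X + (d Nat.+ q Nat.* M) × Y)
          ≈⟨ +-congˡ (+-cong
               (trans (×-homo-+ X d (N Nat.* B q))
                      (+-congˡ (trans (×-congˡ (ℕₚ.*-comm N (B q))) (sym (×-assocˡ X (B q) N)))))
               (trans (×-homo-+ Y d (q Nat.* M)) (+-congˡ (sym (×-assocˡ Y q M))))) ⟩
        z + ((d × X + B q × (N × X)) + (d × Y + q × (M × Y)))
          ≈⟨ solve 5 (λ z a b c e → z :+ ((a :+ b) :+ (c :+ e)) := (z :+ (a :+ c)) :+ (b :+ e))
                     refl _ _ _ _ _ ⟩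
        (z + (d × X + d × Y)) + (B q × (N × X) + q × (M × Y))
          ≈⟨ +-congʳ (+-congˡ (sym (×-distrib-+ X Y d))) ⟩
        (z + d × (X + Y)) + (B q × (N × X) + q × (M × Y)) ∎

    sumTo-baseShift≈placeSum : 1 < M → ∀ k ω X Y {Ψ} → Congruent₁ Ψ → ∀ z →
      sumTo (M Nat.^ k) (λ n → ω ^ B n * Ψ (z + (B n × X + n × Y))) ≈
      placeSum M (digitPlaces k ω X Y) Ψ z
    sumTo-baseShift≈placeSum 1<M zero    ω X Y Ψ-cong z = trans (+-identityˡ _) (trans (*-identityˡ _)
      (Ψ-cong (trans (+-congˡ (+-identityˡ 0#)) (+-identityʳ z))))
    sumTo-baseShift≈placeSum 1<M (suc k) ω X Y {Ψ} Ψ-cong z = begin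
      sumTo (M Nat.* M Nat.^ k) f
        ≈⟨ reflexive (≡.cong (λ t → sumTo t f) (ℕₚ.*-comm M (M Nat.^ k))) ⟩
      sumTo (M Nat.^ k Nat.* M) f
        ≈⟨ trans (sumTo-* (M Nat.^ k) M f) (sumTo-comm (M Nat.^ k) M _) ⟩
      sumTo M (λ d → sumTo (M Nat.^ k) (λ q → f (d Nat.+ q Nat.* M)))
        ≈⟨ sumTo-cong-< M (λ d d<M →
             trans (sumTo-cong (M Nat.^ k) (λ q → baseShift-term 1<M ω X Y Ψ-cong z d q d<M))
                   (sym (*-distribˡ-sumTo (M Nat.^ k) (ω ^ d) _))) ⟩
      sumTo M (λ d → ω ^ d * sumTo (M Nat.^ k) (λ q →
        (ω ^ N) ^ B q * Ψ ((z + d × (X + Y)) + (B q × (N × X) + q × (M × Y)))))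
        ≈⟨ sumTo-cong M (λ d → *-congˡ
             (sumTo-baseShift≈placeSum 1<M k (ω ^ N) (N × X) (M × Y) Ψ-cong (z + d × (X + Y)))) ⟩
      placeSum M (digitPlaces (suc k) ω X Y) Ψ z ∎
      where
      f : ℕ → Carrier
      f n = ω ^ B n * Ψ (z + (B n × X + n × Y))

    coordinatePlaces : Carrier → ∀ r → (Fin r → ℕ) → (Fin r → Carrier) → (Fin r → Carrier) →
                       List Place
    coordinatePlaces ξ zero    k x y = []
    coordinatePlaces ξ (suc r) k x y = digitPlaces (k Fin.zero) ξ (x Fin.zero) (y Fin.zero)
      ++ coordinatePlaces ξ r (k ∘ Fin.suc) (x ∘ Fin.suc) (y ∘ Fin.suc)

    multiSum≈placeSum : 1 < M → ∀ ξ r k x y {Φ} → Congruent₁ Φ → ∀ z →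
      multiSum (tabulate (λ j → M Nat.^ k j)) (λ n → ξ ^ sumFinℕ r (λ j → B (lookup n j))
        * Φ (z + sumFin r (λ j → (B (lookup n j) × x j) + (lookup n j × y j))))
      ≈ placeSum M (coordinatePlaces ξ r k x y) Φ z
    multiSum≈placeSum 1<M ξ zero    k x y Φ-cong z = trans (*-identityˡ _) (Φ-cong (+-identityʳ z))
    multiSum≈placeSum 1<M ξ (suc r) k x y {Φ} Φ-cong z = begin
      sumTo (M Nat.^ k Fin.zero) (λ n₀ → multiSum bs (λ ns →
        ξ ^ (B n₀ Nat.+ sumFinℕ r (λ j → B (lookup ns j))) * Φ (z + (L n₀ + rest ns))))
        ≈⟨ sumTo-cong (M Nat.^ k Fin.zero) (λ n₀ →
             trans (multiSum-cong bs (λ ns → split n₀ _ (rest ns)))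
             (trans (sym (*-distribˡ-multiSum bs (ξ ^ B n₀) _))
                    (*-congˡ (multiSum≈placeSum 1<M ξ r (k ∘ Fin.suc) (x ∘ Fin.suc) (y ∘ Fin.suc)
                                                 Φ-cong (z + L n₀))))) ⟩
      sumTo (M Nat.^ k Fin.zero) (λ n₀ → ξ ^ B n₀ * placeSum M V Φ (z + L n₀))
        ≈⟨ sumTo-baseShift≈placeSum 1<M (k Fin.zero) ξ (x Fin.zero) (y Fin.zero)
                                    (placeSum-preserves-≈ M V Φ-cong) z ⟩
      placeSum M (digitPlaces (k Fin.zero) ξ (x Fin.zero) (y Fin.zero)) (placeSum M V Φ) z
        ≈⟨ sym (placeSum-++ M (digitPlaces (k Fin.zero) ξ (x Fin.zero) (y Fin.zero)) V Φ z) ⟩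
      placeSum M (coordinatePlaces ξ (suc r) k x y) Φ z ∎
      where
      bs : Vec ℕ r
      bs = tabulate (λ j → M Nat.^ k (Fin.suc j))
      V : List Place
      V = coordinatePlaces ξ r (k ∘ Fin.suc) (x ∘ Fin.suc) (y ∘ Fin.suc)
      L : ℕ → Carrier
      L n₀ = B n₀ × x Fin.zero + n₀ × y Fin.zero
      rest : Vec ℕ r → Carrier
      rest ns = sumFin r (λ j → (B (lookup ns j) × x (Fin.suc j)) + (lookup ns j × y (Fin.suc j)))
      split : ∀ n₀ s t → ξ ^ (B n₀ Nat.+ s) * Φ (z + (L n₀ + t)) ≈
                         ξ ^ B n₀ * (ξ ^ s * Φ ((z + L n₀) + t))
      split n₀ s t =
        trans (*-cong (^-homo-* ξ (B n₀) s) (Φ-cong (sym (+-assoc z (L n₀) t)))) (*-assoc _ _ _)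

    length-digitPlaces : ∀ k ω X Y → length (digitPlaces k ω X Y) ≡ k
    length-digitPlaces zero    ω X Y = ≡.refl
    length-digitPlaces (suc k) ω X Y = ≡.cong suc (length-digitPlaces k _ _ _)

    length-coordinatePlaces : ∀ ξ r k x y → length (coordinatePlaces ξ r k x y) ≡ sumFinℕ r k
    length-coordinatePlaces ξ zero    k x y = ≡.refl
    length-coordinatePlaces ξ (suc r) k x y =
      ≡.trans (length-++ (digitPlaces (k Fin.zero) ξ (x Fin.zero) (y Fin.zero)))
              (≡.cong₂ Nat._+_ (length-digitPlaces _ _ _ _) (length-coordinatePlaces ξ r _ _ _))

    All-coordinatePlaces : ∀ {p} {P : Place → Set p} ξ → (∀ k X Y → All P (digitPlaces k ξ X Y)) →
                           ∀ r k x y → All P (coordinatePlaces ξ r k x y)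
    All-coordinatePlaces ξ all-digits zero    k x y = []
    All-coordinatePlaces ξ all-digits (suc r) k x y =
      ++⁺ (all-digits _ _ _) (All-coordinatePlaces ξ all-digits r _ _ _)

    prodMap-coordinatePlaces : ∀ f ξ r k x y →
      prodMap f (coordinatePlaces ξ r k x y) ≈
      prodFin r (λ j → prodMap f (digitPlaces (k j) ξ (x j) (y j)))
    prodMap-coordinatePlaces f ξ zero    k x y = refl
    prodMap-coordinatePlaces f ξ (suc r) k x y =
      trans (prodMap-++ f (digitPlaces (k Fin.zero) ξ (x Fin.zero) (y Fin.zero)) _)
            (*-congˡ (prodMap-coordinatePlaces f ξ r _ _ _))

    prodMap-coeff-digitPlaces : ∀ k ω X Y →
      prodMap coeff (digitPlaces k ω X Y) ≈ prodTo k (λ i → (N Nat.^ i) × X + (M Nat.^ i) × Y)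
    prodMap-coeff-digitPlaces zero    ω X Y = refl
    prodMap-coeff-digitPlaces (suc k) ω X Y = trans
      (*-cong (sym (+-cong (×-homo-1 X) (×-homo-1 Y)))
              (trans (prodMap-coeff-digitPlaces k (ω ^ N) (N × X) (M × Y))
                     (prodTo-cong k (λ i → +-cong (pull X N i) (pull Y M i)))))
      (sym (prodTo-suc k _))
      where
      pull : ∀ U K i → (K Nat.^ i) × (K × U) ≈ (K Nat.^ suc i) × U
      pull U K i = trans (×-assocˡ U (K Nat.^ i) K) (×-congˡ (ℕₚ.*-comm (K Nat.^ i) K))

    prodMap-[1-phase]-digitPlaces : ∀ k ω X Y →
      prodMap (λ p → 1# - phase p) (digitPlaces k ω X Y) ≈ prodTo k (λ i → 1# - ω ^ (N Nat.^ i))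
    prodMap-[1-phase]-digitPlaces zero    ω X Y = refl
    prodMap-[1-phase]-digitPlaces (suc k) ω X Y = trans
      (*-cong (+-congˡ (-‿cong (sym (*-identityʳ ω))))
              (trans (prodMap-[1-phase]-digitPlaces k (ω ^ N) (N × X) (M × Y))
                     (prodTo-cong k (λ i → +-congˡ (-‿cong (^-assocʳ ω N (N Nat.^ i)))))))
      (sym (prodTo-suc k _))

    phase^M≈1-digitPlaces : ∀ {ω} → ω ^ M ≈ 1# → ∀ k X Y →
                            All (λ p → phase p ^ M ≈ 1#) (digitPlaces k ω X Y)
    phase^M≈1-digitPlaces ω^M≈1 zero    X Y = []
    phase^M≈1-digitPlaces {ω} ω^M≈1 (suc k) X Y =
      ω^M≈1 ∷ phase^M≈1-digitPlaces [ω^N]^M≈1 k (N × X) (M × Y)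
      where
      [ω^N]^M≈1 : (ω ^ N) ^ M ≈ 1#
      [ω^N]^M≈1 = begin
        (ω ^ N) ^ M    ≈⟨ ^-assocʳ ω N M ⟩
        ω ^ (N Nat.* M) ≡⟨ ≡.cong (ω ^_) (ℕₚ.*-comm N M) ⟩
        ω ^ (M Nat.* N) ≈⟨ sym (^-assocʳ ω M N) ⟩
        (ω ^ M) ^ N    ≈⟨ ^-congˡ N ω^M≈1 ⟩
        1# ^ N         ≈⟨ 1#^n≈1# N ⟩
        1#             ∎

    powerSum-coordinatePlaces : ∀ ξ → ξ ^ M ≈ 1# → ∀ r k x y d →
      let D = sumFinℕ r k in
      prodFin r (λ j → prodTo (k j) (λ i → 1# - ξ ^ (N Nat.^ i))) * d ≈ 1# → ∀ z →
      powerSum M (coordinatePlaces ξ r k x y) D z ≈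
      ((D !) × 1#) * (prodFin r (λ j → prodTo (k j) (λ i → (N Nat.^ i) × x j + (M Nat.^ i) × y j))
                      * ((- (M × 1#)) ^ D * d))
    powerSum-coordinatePlaces ξ ξ^M≈1 r k x y d denom*d≈1 z = trans
      (powerSum-closedForm M V d
        (All-coordinatePlaces ξ (phase^M≈1-digitPlaces ξ^M≈1) r k x y)
        (trans (*-congʳ (trans (prodMap-coordinatePlaces _ ξ r k x y)
          (prodFin-cong r (λ j → prodMap-[1-phase]-digitPlaces (k j) ξ (x j) (y j))))) denom*d≈1)
        (length-coordinatePlaces ξ r k x y) z)
      (*-congˡ (*-congʳ (trans (prodMap-coordinatePlaces coeff ξ r k x y)
        (prodFin-cong r (λ j → prodMap-coeff-digitPlaces (k j) ξ (x j) (y j))))))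
      where
      V : List Place
      V = coordinatePlaces ξ r k x y

theorem5p6 : ∀ {c ℓ : Level} (R : CommutativeRing c ℓ) →
    let open CommutativeRing R
        open RingDefs R
    in IsCharZeroField →
       (M N : ℕ) .{{_ : NonZero M}} → 2 ≤ M → 1 ≤ N → ¬ (rad M ∣ rad N) →
       (ξ : Carrier) → IsPrimitiveRoot M ξ →
       (r : ℕ) → 1 ≤ r → (p : Fin r → ℕ) (x y : Fin r → Carrier) →
       let D = sumFinℕ r (λ j → suc (p j))
           B = baseShift M N
           lhs = multiSum (tabulate (λ j → M Nat.^ suc (p j))) (λ n →
                   ξ ^ sumFinℕ r (λ j → B (lookup n j))
                   * (sumFin r (λ j → (B (lookup n j) × x j) + (lookup n j × y j))) ^ D)
           numer = prodFin r (λ j → prodTo (suc (p j)) (λ i →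
                     ((N Nat.^ i) × x j) + ((M Nat.^ i) × y j)))
           denom = prodFin r (λ j → prodTo (suc (p j)) (λ i →
                     1# - ξ ^ (N Nat.^ i)))
       in (d : Carrier) → denom * d ≈ 1# →
          lhs ≈ (- 1#) ^ D * ((D ! Nat.* M Nat.^ D) × 1#) * numer * d
-- In the paper the field, primitivity and rad hypotheses only make the
-- denominator nonzero; with its inverse d given, the identity holds in any
-- commutative ring as soon as ξ ^ M ≈ 1#.
theorem5p6 R _ M N 2≤M _ _ ξ (ξ^M≈1 , _) r _ p x y d denom*d≈1 = begin
  multiSum bs (λ n → ξ ^ phaseExponent n * linearForm n ^ D)
    ≈⟨ multiSum-cong bs (λ n → *-congˡ (^-congˡ D (sym (+-identityˡ (linearForm n))))) ⟩
  multiSum bs (λ n → ξ ^ phaseExponent n * (0# + linearForm n) ^ D)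
    ≈⟨ multiSum≈placeSum M N 2≤M ξ r k x y (^-congˡ D) 0# ⟩
  powerSum M (coordinatePlaces M N ξ r k x y) D 0#
    ≈⟨ powerSum-coordinatePlaces M N ξ ξ^M≈1 r k x y d denom*d≈1 0# ⟩
  ((D !) × 1#) * (numer * ((- (M × 1#)) ^ D * d))
    ≈⟨ closedForm-normalise M D numer d ⟩
  (- 1#) ^ D * ((D ! Nat.* M Nat.^ D) × 1#) * numer * d ∎
  where
  open CommutativeRing R
  open RingDefs R
  open Expansion R
  open import Relation.Binary.Reasoning.Setoid setoid
  open import Algebra.Properties.Semiring.Exp semiring using (^-congˡ)
  k : Fin r → ℕ
  k j = suc (p j)
  D : ℕ
  D = sumFinℕ r k
  bs : Vec ℕ r
  bs = tabulate (λ j → M Nat.^ k j)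
  phaseExponent : Vec ℕ r → ℕ
  phaseExponent n = sumFinℕ r (λ j → baseShift M N (lookup n j))
  linearForm : Vec ℕ r → Carrier
  linearForm n = sumFin r (λ j → (baseShift M N (lookup n j) × x j) + (lookup n j × y j))
  numer : Carrier
  numer = prodFin r (λ j → prodTo (k j) (λ i → (N Nat.^ i) × x j + (M Nat.^ i) × y j))
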